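{- For every integer $\ell\ge5$, each of $T_{\mathrm{zigzag}}(\ell)$, $Z_{\mathrm{zigzag}}(\ell)$, $T_{\mathrm{ballot}}(\ell)$ and $Z_{\mathrm{ballot}}(\ell)$ is less than $(2^\ell-7)!$.
   Context: $A_n$ is the Euler zigzag number (OEIS A000111): the number of permutations $\sigma$ of $\{1,\dots,n\}$ with $\sigma_1<\sigma_2>\sigma_3<\cdots$. $\binom{M}{k_1,\dots,k_r}=M!/(k_1!\cdots k_r!)$ with $\sum k_j=M$; $C_n=\frac1{n+1}\binom{2n}{n}$; $\binom ab=0$ for $b<0$; empty products are $1$. For $\ell\ge4$ let $\beta_\ell=A_\ell\binom{2^{\ell}-3}{\ell}\binom{2^{\ell}-3-\ell}{2^{\ell-1}-2,\,2^{\ell-2}-2,\,2^{\ell-3}-1,\,2^{\ell-4}-1,\dots,2^1-1}$ and $\gamma_\ell=A_\ell\binom{2^{\ell}-5}{\ell}\binom{2^{\ell}-5-\ell}{2^{\ell-1}-3,\,2^{\ell-2}-3,\,2^{\ell-3}-1,\,2^{\ell-4}-1,\dots,2^1-1}$, and define $T_{\mathrm{zigzag}}(\ell)=10^{2^{\ell-4}}\beta_\ell\prod_{i=4}^{\ell-1}\beta_i^{2^{\ell-1-i}}$, $Z_{\mathrm{zigzag}}(\ell)=10^{2^{\ell-4}}\gamma_\ell\prod_{i=4}^{\ell-1}\beta_i^{2^{\ell-1-i}}$, $T_{\mathrm{ballot}}(\ell)=10^{2^{\ell-3}}\prod_{i=0}^{\ell-4}\left((2^{\ell-i}-4)C_{2^{\ell-i-1}-1}\right)^{2^i}$,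 $Z_{\mathrm{ballot}}(\ell)=(2^\ell-7)\left(\binom{2^\ell-6}{2^{\ell-1}-3}-\binom{2^\ell-6}{2^{\ell-1}-6}\right)10^{2^{\ell-3}}\prod_{i=0}^{\ell-5}\left((2^{\ell-1-i}-4)C_{2^{\ell-i-2}-1}\right)^{2^{i+1}}$. -}

module Defs where

open import Data.Nat using (ℕ; zero; suc; _+_; _*_; _∸_; _^_; _<_; _<ᵇ_; _!; _/_; NonZero)
open import Data.Nat.Properties using (_!≢0; m*n≢0)
open import Data.Nat.Combinatorics using (_C_)
open import Data.Bool using (Bool; true; false; _∧_; if_then_else_)
open import Data.List using (List; []; _∷_; map; concatMap; upTo; length; filter; _++_)
open import Data.Nat.ListAction using (product)
open import Data.Integer as ℤ using (ℤ; +_)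

insertions : ℕ → List ℕ → List (List ℕ)
insertions x [] = (x ∷ []) ∷ []
insertions x (y ∷ ys) = (x ∷ y ∷ ys) ∷ map (y ∷_) (insertions x ys)

perms : List ℕ → List (List ℕ)
perms [] = [] ∷ []
perms (x ∷ xs) = concatMap (insertions x) (perms xs)

oneTo : ℕ → List ℕ
oneTo n = map suc (upTo n)

mutual
  altUp : List ℕ → Bool
  altUp [] = true
  altUp (x ∷ []) = true
  altUp (x ∷ y ∷ ys) = (x <ᵇ y) ∧ altDown (y ∷ ys)

  altDown : List ℕ → Bool
  altDown [] = true
  altDown (x ∷ []) = true
  altDown (x ∷ y ∷ ys) = (y <ᵇ x) ∧ altUp (y ∷ ys)

zigzag : ℕ → ℕ
zigzag n = length (filter (λ σ → altUp σ Data.Bool.≟ true) (perms (oneTo n)))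
  where import Data.Bool

factProd : List ℕ → ℕ
factProd ks = product (map _! ks)

factProd≢0 : (ks : List ℕ) → NonZero (factProd ks)
factProd≢0 [] = _
factProd≢0 (k ∷ ks) = m*n≢0 (k !) (factProd ks) {{k !≢0}} {{factProd≢0 ks}}

multinomial : ℕ → List ℕ → ℕ
multinomial M ks = (M ! / factProd ks) {{factProd≢0 ks}}

catalan : ℕ → ℕ
catalan n = ((2 * n) C n) / suc n

-- ∏_{i=a}^{b} f i  (empty product = 1 when b < a)
prodRange : ℕ → ℕ → (ℕ → ℕ) → ℕ
prodRange a b f = product (map (λ j → f (a + j)) (upTo (suc b ∸ a)))

tailParts : ℕ → List ℕ
tailParts ℓ = map (λ j → 2 ^ suc j ∸ 1) (upTo (ℓ ∸ 3))

β : ℕ → ℕ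
β ℓ = zigzag ℓ * ((2 ^ ℓ ∸ 3) C ℓ)
      * multinomial (2 ^ ℓ ∸ 3 ∸ ℓ)
          ((2 ^ (ℓ ∸ 1) ∸ 2) ∷ (2 ^ (ℓ ∸ 2) ∸ 2) ∷ tailParts ℓ)

γ : ℕ → ℕ
γ ℓ = zigzag ℓ * ((2 ^ ℓ ∸ 5) C ℓ)
      * multinomial (2 ^ ℓ ∸ 5 ∸ ℓ)
          ((2 ^ (ℓ ∸ 1) ∸ 3) ∷ (2 ^ (ℓ ∸ 2) ∸ 3) ∷ tailParts ℓ)

βProd : ℕ → ℕ
βProd ℓ = prodRange 4 (ℓ ∸ 1) (λ i → β i ^ (2 ^ (ℓ ∸ 1 ∸ i)))

Tzigzag : ℕ → ℕ
Tzigzag ℓ = 10 ^ (2 ^ (ℓ ∸ 4)) * β ℓ * βProd ℓ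

Zzigzag : ℕ → ℕ
Zzigzag ℓ = 10 ^ (2 ^ (ℓ ∸ 4)) * γ ℓ * βProd ℓ

Tballot : ℕ → ℕ
Tballot ℓ = 10 ^ (2 ^ (ℓ ∸ 3))
  * prodRange 0 (ℓ ∸ 4)
      (λ i → ((2 ^ (ℓ ∸ i) ∸ 4) * catalan (2 ^ (ℓ ∸ i ∸ 1) ∸ 1)) ^ (2 ^ i))

-- computed in ℤ because of the (genuine) difference of binomials
Zballot : ℕ → ℤ
Zballot ℓ =
  + (2 ^ ℓ ∸ 7)
  ℤ.* (+ ((2 ^ ℓ ∸ 6) C (2 ^ (ℓ ∸ 1) ∸ 3)) ℤ.- + ((2 ^ ℓ ∸ 6) C (2 ^ (ℓ ∸ 1) ∸ 6)))
  ℤ.* + (10 ^ (2 ^ (ℓ ∸ 3))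
         * prodRange 0 (ℓ ∸ 5)
             (λ i → ((2 ^ (ℓ ∸ 1 ∸ i) ∸ 4) * catalan (2 ^ (ℓ ∸ i ∸ 2) ∸ 1)) ^ (2 ^ suc i)))

module Submission where

-- Each quantity obeys a squaring recursion X(ℓ+1) = a(ℓ)·X(ℓ)²: for Tballot directly, for
-- the two zigzag quantities through their common tail 10^{2^{ℓ-4}}∏βᵢ^{2^{ℓ-1-i}}, and
-- Zballot(ℓ+1) ≤ (2^{ℓ+1}-7)·binom(2^{ℓ+1}-6, 2^ℓ-3)·Tballot(ℓ)². The coefficients a(ℓ) are
-- bounded by quotients of factorials (A_ℓ ≤ ℓ!, binomial and multinomial coefficients,
-- (k+1)·C_k·k!² ≤ (2k)!). With n = 2^ℓ - 7 we have 2^{ℓ+1} - 7 = 2n + 7, and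
-- (2n+7+1)⋯(2n+7+k) < ((n+1)⋯(n+k))² for n ≥ 3, so squaring a bound X(ℓ) < n! leaves
-- room to absorb a(ℓ) below (2n+7)!. For the zigzag tail the induction hypothesis carries
-- the factorial denominators of the multinomial along. The base case ℓ = 5 is a computation.

open import Defs
open import Data.Nat
open import Data.Nat.Properties
open import Data.Nat.Combinatorics using (_C_; nCk≡n!/k![n-k]!; k>n⇒nCk≡0)
open import Data.Nat.DivMod using (m/n*n≤m)
open import Data.Nat.ListAction using (product)
open import Data.Nat.ListAction.Properties using (product-++)
open import Data.Nat.Tactic.RingSolver using (solve-∀)
open import Data.Integer as ℤ using (+_)
import Data.Integer.Properties as ℤ
open import Data.List using (List; []; _∷_; map; concatMap; upTo; length; _++_)
open import Data.List.Properties
  using (length-map; length-++; length-filter; length-upTo; map-cong; map-cong-local; map-++; map-∘; map-upTo;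
         map-applyUpTo; upTo-∷ʳ)
open import Data.List.Relation.Unary.All as All using (All; []; _∷_)
import Data.List.Relation.Unary.All.Properties as All
open import Data.Product using (_×_; _,_)
open import Data.Unit using (tt)
open import Function using (_∘_; it)
open import Relation.Binary.PropositionalEquality
open import Relation.Nullary using (yes; no)
open import Algebra.Properties.CommutativeSemigroup *-commutativeSemigroup using (interchange; x∙yz≈y∙xz)

-- Counting permutations

length-insertions : ∀ x ys → length (insertions x ys) ≡ suc (length ys)
length-insertions x [] = refl
length-insertions x (y ∷ ys) =
  cong suc (trans (length-map (y ∷_) (insertions x ys)) (length-insertions x ys))

length-∈-insertions : ∀ x ys → All (λ zs → length zs ≡ suc (length ys)) (insertions x ys)
length-∈-insertions x [] = refl ∷ []
length-∈-insertions x (y ∷ ys) = refl ∷ All.map⁺ (All.map (cong suc) (length-∈-insertions x ys))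

length-∈-perms : ∀ xs → All (λ σ → length σ ≡ length xs) (perms xs)
length-∈-perms [] = refl ∷ []
length-∈-perms (x ∷ xs) = All.concat⁺ (All.map⁺ (All.map grow (length-∈-perms xs)))
  where
  grow : ∀ {σ} → length σ ≡ length xs → All (λ τ → length τ ≡ suc (length xs)) (insertions x σ)
  grow {σ} eq = subst (λ k → All (λ τ → length τ ≡ suc k) (insertions x σ)) eq (length-∈-insertions x σ)

length-concatMap : ∀ {A B : Set} {k} (f : A → List B) xs →
  All (λ x → length (f x) ≡ k) xs → length (concatMap f xs) ≡ length xs * k
length-concatMap f [] [] = refl
length-concatMap f (x ∷ xs) (eq ∷ eqs) =
  trans (length-++ (f x)) (cong₂ _+_ eq (length-concatMap f xs eqs))

length-perms : ∀ xs → length (perms xs) ≡ length xs !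
length-perms [] = refl
length-perms (x ∷ xs) = begin
  length (concatMap (insertions x) (perms xs))
    ≡⟨ length-concatMap (insertions x) (perms xs) (All.map (λ {σ} → grow σ) (length-∈-perms xs)) ⟩
  length (perms xs) * suc (length xs)   ≡⟨ cong (_* suc (length xs)) (length-perms xs) ⟩
  length xs ! * suc (length xs)         ≡⟨ *-comm (length xs !) (suc (length xs)) ⟩
  suc (length xs) !                     ∎
  where
  open ≡-Reasoning
  grow : ∀ σ → length σ ≡ length xs → length (insertions x σ) ≡ suc (length xs)
  grow σ eq = trans (length-insertions x σ) (cong suc eq)

zigzag≤n! : ∀ n → zigzag n ≤ n !
zigzag≤n! n = begin
  zigzag n                   ≤⟨ length-filter _ (perms (oneTo n)) ⟩
  length (perms (oneTo n))   ≡⟨ length-perms (oneTo n) ⟩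
  length (oneTo n) !         ≡⟨ cong _! (trans (length-map suc (upTo n)) (length-upTo n)) ⟩
  n !                        ∎
  where open ≤-Reasoning

nCk*[k!*[n∸k]!]≤n! : ∀ n k → (n C k) * (k ! * (n ∸ k) !) ≤ n !
nCk*[k!*[n∸k]!]≤n! n k with k ≤? n
... | yes k≤n rewrite nCk≡n!/k![n-k]! k≤n = m/n*n≤m (n !) (k ! * (n ∸ k) !) {{k !* (n ∸ k) !≢0}}
... | no k≰n rewrite k>n⇒nCk≡0 (≰⇒> k≰n) = z≤n

multinomial*factProd≤M! : ∀ M ks → multinomial M ks * factProd ks ≤ M !
multinomial*factProd≤M! M ks = m/n*n≤m (M !) (factProd ks) {{factProd≢0 ks}}

zigzag-multinomial-bound : ∀ ℓ M ks → zigzag ℓ * (M C ℓ) * multinomial (M ∸ ℓ) ks * factProd ks ≤ M !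
zigzag-multinomial-bound ℓ M ks = begin
  zigzag ℓ * (M C ℓ) * multinomial (M ∸ ℓ) ks * factProd ks
    ≡⟨ *-assoc (zigzag ℓ * (M C ℓ)) _ _ ⟩
  zigzag ℓ * (M C ℓ) * (multinomial (M ∸ ℓ) ks * factProd ks)
    ≤⟨ *-mono-≤ (*-monoˡ-≤ (M C ℓ) (zigzag≤n! ℓ)) (multinomial*factProd≤M! (M ∸ ℓ) ks) ⟩
  ℓ ! * (M C ℓ) * (M ∸ ℓ) !
    ≡⟨ trans (cong (_* (M ∸ ℓ) !) (*-comm (ℓ !) (M C ℓ))) (*-assoc (M C ℓ) _ _) ⟩
  (M C ℓ) * (ℓ ! * (M ∸ ℓ) !)
    ≤⟨ nCk*[k!*[n∸k]!]≤n! M ℓ ⟩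
  M ! ∎
  where open ≤-Reasoning

catalan-bound : ∀ k → catalan k * suc k * (k ! * k !) ≤ (2 * k) !
catalan-bound k = begin
  catalan k * suc k * (k ! * k !)         ≤⟨ *-monoˡ-≤ (k ! * k !) (m/n*n≤m ((2 * k) C k) (suc k)) ⟩
  ((2 * k) C k) * (k ! * k !)             ≡⟨ cong (λ x → ((2 * k) C k) * (k ! * x !)) (sym 2k∸k≡k) ⟩
  ((2 * k) C k) * (k ! * (2 * k ∸ k) !)   ≤⟨ nCk*[k!*[n∸k]!]≤n! (2 * k) k ⟩
  (2 * k) !                               ∎
  where
  open ≤-Reasoning
  2k∸k≡k : 2 * k ∸ k ≡ k
  2k∸k≡k = trans (cong (_∸ k) (cong (λ x → k + x) (+-identityʳ k))) (m+n∸m≡n k k)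

βParts γParts : ℕ → List ℕ
βParts ℓ = (2 ^ (ℓ ∸ 1) ∸ 2) ∷ (2 ^ (ℓ ∸ 2) ∸ 2) ∷ tailParts ℓ
γParts ℓ = (2 ^ (ℓ ∸ 1) ∸ 3) ∷ (2 ^ (ℓ ∸ 2) ∸ 3) ∷ tailParts ℓ

β-bound : ∀ ℓ → β ℓ * factProd (βParts ℓ) ≤ (2 ^ ℓ ∸ 3) !
β-bound ℓ = zigzag-multinomial-bound ℓ (2 ^ ℓ ∸ 3) (βParts ℓ)

γ-bound : ∀ ℓ → γ ℓ * factProd (γParts ℓ) ≤ (2 ^ ℓ ∸ 5) !
γ-bound ℓ = zigzag-multinomial-bound ℓ (2 ^ ℓ ∸ 5) (γParts ℓ)

rising : ℕ → ℕ → ℕ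
rising n zero = 1
rising n (suc k) = (suc k + n) * rising n k

+!≡rising*! : ∀ k n → (k + n) ! ≡ rising n k * n !
+!≡rising*! zero n = sym (+-identityʳ (n !))
+!≡rising*! (suc k) n = begin
  (suc k + n) * (k + n) !            ≡⟨ cong ((suc k + n) *_) (+!≡rising*! k n) ⟩
  (suc k + n) * (rising n k * n !)   ≡⟨ *-assoc (suc k + n) (rising n k) (n !) ⟨
  rising n (suc k) * n !             ∎
  where open ≡-Reasoning

rising-monoʳ-≤ : ∀ n {k j} → k ≤ j → rising n k ≤ rising n j
rising-monoʳ-≤ n {j = zero} z≤n = ≤-refl
rising-monoʳ-≤ n {j = suc j} z≤n = ≤-trans (rising-monoʳ-≤ n {j = j} z≤n) (m≤n*m (rising n j) (suc j + n))
rising-monoʳ-≤ n (s≤s k≤j) = *-mono-≤ (+-monoˡ-≤ n (s≤s k≤j)) (rising-monoʳ-≤ n k≤j)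

m+o≡n⇒m≤n : ∀ {m n} o → m + o ≡ n → m ≤ n
m+o≡n⇒m≤n {m} o refl = m≤m+n m o

rising-double< : ∀ {n} k → 3 ≤ n → rising (7 + (n + n)) (suc k) < rising n (suc k) * rising n (suc k)
rising-double< {suc (suc (suc r))} zero (s≤s (s≤s (s≤s _))) = m+o≡n⇒m≤n (1 + (6 * r + r * r)) (base r)
  where
  base : ∀ r → suc ((1 + (7 + ((3 + r) + (3 + r)))) * 1) + (1 + (6 * r + r * r))
             ≡ ((1 + (3 + r)) * 1) * ((1 + (3 + r)) * 1)
  base = solve-∀
rising-double< {n@(suc (suc (suc r)))} (suc k) 3≤n@(s≤s (s≤s (s≤s _))) = begin-strict
  a * rising n′ (suc k)                             ≤⟨ *-monoˡ-≤ (rising n′ (suc k)) a≤b*b ⟩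
  b * b * rising n′ (suc k)                         <⟨ *-monoʳ-< (b * b) (rising-double< k 3≤n) ⟩
  b * b * (rising n (suc k) * rising n (suc k))     ≡⟨ interchange b b (rising n (suc k)) (rising n (suc k)) ⟩
  (b * rising n (suc k)) * (b * rising n (suc k))   ∎
  where
  open ≤-Reasoning
  n′ = 7 + (n + n)
  a = 2 + k + n′
  b = 2 + k + n
  step : ∀ k r → (2 + k + (7 + ((3 + r) + (3 + r)))) + (10 + (9 * k + 8 * r + k * k + 2 * k * r + r * r))
               ≡ (2 + k + (3 + r)) * (2 + k + (3 + r))
  step = solve-∀
  a≤b*b : a ≤ b * b
  a≤b*b = m+o≡n⇒m≤n _ (step k r)

-- Propagating bounds through a squaring step

square-bound : ∀ {x Q S t d G} → x * Q ≤ S → t ≤ d → S * (d * d) < G * Q → x * (t * t) < G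
square-bound {x} {Q} {S} {t} {d} {G} xQ≤S t≤d SD<GQ = *-cancelʳ-< Q (x * (t * t)) G (begin-strict
  x * (t * t) * Q   ≡⟨ swap x (t * t) Q ⟩
  x * Q * (t * t)   ≤⟨ *-mono-≤ xQ≤S (*-mono-≤ t≤d t≤d) ⟩
  S * (d * d)       <⟨ SD<GQ ⟩
  G * Q             ∎)
  where
  open ≤-Reasoning
  swap : ∀ a b c → a * b * c ≡ a * c * b
  swap = solve-∀

square-invariant : ∀ {b u c d F} .{{_ : NonZero (c * F)}} →
  b * F ≤ c → u * c ≤ d * F → b * (u * u) * c ≤ d * d * F
square-invariant {b} {u} {c} {d} {F} bF≤c uc≤dF = *-cancelʳ-≤ (b * (u * u) * c) (d * d * F) (c * F) (begin
  b * (u * u) * c * (c * F)   ≡⟨ regroupˡ b u c F ⟩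
  b * F * (u * c * (u * c))   ≤⟨ *-mono-≤ bF≤c (*-mono-≤ uc≤dF uc≤dF) ⟩
  c * (d * F * (d * F))       ≡⟨ regroupʳ c d F ⟩
  d * d * F * (c * F)         ∎)
  where
  open ≤-Reasoning
  regroupˡ : ∀ b u c F → b * (u * u) * c * (c * F) ≡ b * F * (u * c * (u * c))
  regroupˡ = solve-∀
  regroupʳ : ∀ c d F → c * (d * F * (d * F)) ≡ d * d * F * (c * F)
  regroupʳ = solve-∀

-- In the application b = β ℓ, u is the zigzag tail, c = (N-3)!, d = (N-7)!, A = (N/2-2)!,
-- B = (N/4-2)! and E = ∏(2^j-1)! for N = 2^ℓ; G₃, G₇, A₂, B′ are (2N-3)!, (2N-7)!, (N-2)!, (N/4-1)!.
zigzag-propagation : ∀ {b u c d A B E G₃ G₇ A₂ B′} .{{_ : NonZero c}} .{{_ : NonZero A}} .{{_ : NonZero B}}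
  .{{_ : NonZero E}} → b * (A * (B * E)) ≤ c → u * c < d * (A * (B * E)) →
  d * d * (B * G₃) < G₇ * (A₂ * (B′ * c)) → b * (u * u) * G₃ < G₇ * (A₂ * (A * (E * B′)))
zigzag-propagation {b} {u} {c} {d} {A} {B} {E} {G₃} {G₇} {A₂} {B′} bF≤c uc<dF growth =
  *-cancelʳ-< c (b * (u * u) * G₃) (G₇ * (A₂ * (A * (E * B′)))) (begin-strict
    b * (u * u) * G₃ * c             ≡⟨ swap (b * (u * u)) G₃ c ⟩
    b * (u * u) * c * G₃             ≤⟨ *-monoˡ-≤ G₃ squared ⟩
    d * d * (A * (B * E)) * G₃       ≡⟨ regroupˡ d A B E G₃ ⟩
    A * E * (d * d * (B * G₃))       <⟨ *-monoʳ-< (A * E) {{m*n≢0 A E}} growth ⟩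
    A * E * (G₇ * (A₂ * (B′ * c)))   ≡⟨ regroupʳ A E G₇ A₂ B′ c ⟩
    G₇ * (A₂ * (A * (E * B′))) * c   ∎)
  where
  open ≤-Reasoning
  squared : b * (u * u) * c ≤ d * d * (A * (B * E))
  squared = square-invariant {b} {u} {c} {d} {{m*n≢0 c _ {{it}} {{m*n≢0 A (B * E) {{it}} {{m*n≢0 B E}}}}}}
              bF≤c (<⇒≤ uc<dF)
  swap : ∀ a b c → a * b * c ≡ a * c * b
  swap = solve-∀
  regroupˡ : ∀ d A B E G → d * d * (A * (B * E)) * G ≡ A * E * (d * d * (B * G))
  regroupˡ = solve-∀
  regroupʳ : ∀ A E G A₂ B′ c → A * E * (G * (A₂ * (B′ * c))) ≡ G * (A₂ * (A * (E * B′))) * c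
  regroupʳ = solve-∀

ratio-bound : ∀ {g u c d e F F′} .{{_ : NonZero e}} →
  g * F′ ≤ e → u * c < d * F → e * F ≤ c * F′ → g * u < d
ratio-bound {g} {u} {c} {d} {e} {F} {F′} gF′≤e uc<dF eF≤cF′ = *-cancelʳ-< (F′ * c) (g * u) d (begin-strict
  g * u * (F′ * c)   ≡⟨ regroup g u F′ c ⟩
  g * F′ * (u * c)   ≤⟨ *-monoˡ-≤ (u * c) gF′≤e ⟩
  e * (u * c)        <⟨ *-monoʳ-< e uc<dF ⟩
  e * (d * F)        ≡⟨ x∙yz≈y∙xz e d F ⟩
  d * (e * F)        ≤⟨ *-monoʳ-≤ d eF≤cF′ ⟩
  d * (c * F′)       ≡⟨ cong (d *_) (*-comm c F′) ⟩
  d * (F′ * c)       ∎)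
  where
  open ≤-Reasoning
  regroup : ∀ g u F′ c → g * u * (F′ * c) ≡ g * F′ * (u * c)
  regroup = solve-∀

-- k₂ = N - 3 and k = N - 5, while a and b are N/2 - 3 and N/4 - 3.
factorial-ratio : ∀ {k k₂ a a₂ b b₂} E → k₂ ≡ 2 + k → a₂ ≡ suc a → b₂ ≡ suc b → a₂ ≤ k₂ → b₂ ≤ suc k →
  k ! * (a₂ ! * (b₂ ! * E)) ≤ k₂ ! * (a ! * (b ! * E))
factorial-ratio {k} {a = a} {b = b} E refl refl refl a₂≤k₂ b₂≤k₁ = begin
  k ! * (suc a * a ! * (suc b * b ! * E))       ≡⟨ regroup (k !) (suc a) (a !) (suc b) (b !) E ⟩
  suc a * suc b * (k ! * (a ! * (b ! * E)))     ≤⟨ *-monoˡ-≤ _ (*-mono-≤ a₂≤k₂ b₂≤k₁) ⟩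
  (2 + k) * suc k * (k ! * (a ! * (b ! * E)))   ≡⟨ regroup′ (2 + k) (suc k) (k !) (a ! * (b ! * E)) ⟩
  (2 + k) * (suc k * k !) * (a ! * (b ! * E))   ∎
  where
  open ≤-Reasoning
  regroup : ∀ x p y q z E → x * (p * y * (q * z * E)) ≡ p * q * (x * (y * (z * E)))
  regroup = solve-∀
  regroup′ : ∀ p q x r → p * q * (x * r) ≡ p * (q * x) * r
  regroup′ = solve-∀

subtraction-bound : ∀ {a b c z F} → a * b * z < F → + a ℤ.* (+ b ℤ.- + c) ℤ.* + z ℤ.< + F
subtraction-bound {a} {b} {c} {z} {F} abz<F = ℤ.≤-<-trans drop (ℤ.+<+ abz<F)
  where
  drop : + a ℤ.* (+ b ℤ.- + c) ℤ.* + z ℤ.≤ + (a * b * z)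
  drop = ℤ.≤-trans (ℤ.*-monoʳ-≤-nonNeg (+ z) (ℤ.*-monoˡ-≤-nonNeg (+ a) (ℤ.i-j≤i (+ b) (+ c))))
           (ℤ.≤-reflexive (trans (cong (ℤ._* + z) (sym (ℤ.pos-* a b))) (sym (ℤ.pos-* (a * b) z))))

-- Factorial inequalities between consecutive levels, with N = n + 7 and n′ = 2N - 7

-- c₂ = N - 2, c₃ = N - 3, c′₃ = 2N - 3.
zigzag-growth : ∀ {n c₂ c₃ n′ c′₃ h h′} → 3 ≤ n →
  c₂ ≡ 5 + n → c₃ ≡ 4 + n → n′ ≡ 7 + (n + n) → c′₃ ≡ 4 + n′ → h′ ≡ suc h →
  n ! * n ! * (h ! * c′₃ !) < n′ ! * (c₂ ! * (h′ ! * c₃ !))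
zigzag-growth {n} {n′ = n′} {h = h} 3≤n refl refl refl refl refl = begin-strict
  n ! * n ! * (h ! * (4 + n′) !)           ≡⟨ cong (λ x → n ! * n ! * (h ! * x)) (+!≡rising*! 4 n′) ⟩
  n ! * n ! * (h ! * (rising n′ 4 * n′ !)) ≡⟨ regroupˡ (n !) (h !) (rising n′ 4) (n′ !) ⟩
  rising n′ 4 * K                          <⟨ *-monoˡ-< K {{K≢0}} rising< ⟩
  rising n 5 * (suc h * rising n 4) * K    ≡⟨ regroupʳ (n !) (h !) (rising n 5) (suc h) (rising n 4) (n′ !) ⟩
  n′ ! * (rising n 5 * n ! * (suc h * h ! * (rising n 4 * n !)))
    ≡⟨ cong₂ (λ x y → n′ ! * (x * (suc h * h ! * y))) (+!≡rising*! 5 n) (+!≡rising*! 4 n) ⟨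
  n′ ! * ((5 + n) ! * (suc h ! * (4 + n) !)) ∎
  where
  open ≤-Reasoning
  K = n ! * n ! * h ! * n′ !
  K≢0 : NonZero K
  K≢0 = m*n≢0 _ _ {{m*n≢0 _ _ {{n !* n !≢0}} {{h !≢0}}}} {{n′ !≢0}}
  rising< : rising n′ 4 < rising n 5 * (suc h * rising n 4)
  rising< = <-≤-trans (rising-double< 3 3≤n)
              (*-mono-≤ (rising-monoʳ-≤ n (n≤1+n 4)) (m≤n*m (rising n 4) (suc h)))
  regroupˡ : ∀ a b r c → a * a * (b * (r * c)) ≡ r * (a * a * b * c)
  regroupˡ = solve-∀
  regroupʳ : ∀ a b r₅ s r₄ c → r₅ * (s * r₄) * (a * a * b * c) ≡ c * (r₅ * a * (s * b * (r₄ * a)))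
  regroupʳ = solve-∀

-- f = 2N - 4, k = N - 1.
ballot-growth : ∀ {n n′ f k t} → 3 ≤ n → n′ ≡ 7 + (n + n) → f ≡ 3 + n′ → k ≡ 6 + n → t ≤ n ! →
  f * catalan k * (t * t) < n′ !
ballot-growth {n} 3≤n refl refl refl t≤n! =
  square-bound {x = (3 + n′) * catalan (6 + n)} catalan≤ t≤n! growth
  where
  n′ = 7 + (n + n)
  K = n′ ! * (n ! * n !)
  catalan≤ : (3 + n′) * catalan (6 + n) * ((7 + n) * ((6 + n) ! * (6 + n) !)) ≤ (3 + n′) * (5 + n′) !
  catalan≤ = begin
    (3 + n′) * catalan (6 + n) * ((7 + n) * ((6 + n) ! * (6 + n) !))
      ≡⟨ regroup (3 + n′) (catalan (6 + n)) (7 + n) ((6 + n) !) ⟩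
    (3 + n′) * (catalan (6 + n) * (7 + n) * ((6 + n) ! * (6 + n) !))
      ≤⟨ *-monoʳ-≤ (3 + n′) (catalan-bound (6 + n)) ⟩
    (3 + n′) * (2 * (6 + n)) !
      ≡⟨ cong (λ x → (3 + n′) * x !) (double n) ⟩
    (3 + n′) * (5 + n′) ! ∎
    where
    open ≤-Reasoning
    regroup : ∀ f c s a → f * c * (s * (a * a)) ≡ f * (c * s * (a * a))
    regroup = solve-∀
    double : ∀ n → 2 * (6 + n) ≡ 5 + (7 + (n + n))
    double = solve-∀
  rising< : (3 + n′) * rising n′ 5 < (7 + n) * (rising n 6 * rising n 6)
  rising< = begin-strict
    (3 + n′) * rising n′ 5    ≤⟨ *-monoˡ-≤ (rising n′ 5) (m≤n+m (3 + n′) 3) ⟩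
    rising n′ 6               <⟨ rising-double< 5 3≤n ⟩
    rising n 6 * rising n 6   ≤⟨ m≤n*m (rising n 6 * rising n 6) (7 + n) ⟩
    (7 + n) * (rising n 6 * rising n 6) ∎
    where open ≤-Reasoning
  growth : (3 + n′) * (5 + n′) ! * (n ! * n !) < n′ ! * ((7 + n) * ((6 + n) ! * (6 + n) !))
  growth = begin-strict
    (3 + n′) * (5 + n′) ! * (n ! * n !)
      ≡⟨ cong (λ x → (3 + n′) * x * (n ! * n !)) (+!≡rising*! 5 n′) ⟩
    (3 + n′) * (rising n′ 5 * n′ !) * (n ! * n !)
      ≡⟨ regroupˡ (3 + n′) (rising n′ 5) (n′ !) (n !) ⟩
    (3 + n′) * rising n′ 5 * K
      <⟨ *-monoˡ-< K {{m*n≢0 _ _ {{n′ !≢0}} {{n !* n !≢0}}}} rising< ⟩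
    (7 + n) * (rising n 6 * rising n 6) * K
      ≡⟨ regroupʳ (7 + n) (rising n 6) (n′ !) (n !) ⟩
    n′ ! * ((7 + n) * (rising n 6 * n ! * (rising n 6 * n !)))
      ≡⟨ cong (λ x → n′ ! * ((7 + n) * (x * x))) (+!≡rising*! 6 n) ⟨
    n′ ! * ((7 + n) * ((6 + n) ! * (6 + n) !)) ∎
    where
    open ≤-Reasoning
    regroupˡ : ∀ f r c a → f * (r * c) * (a * a) ≡ f * r * (c * (a * a))
    regroupˡ = solve-∀
    regroupʳ : ∀ s r c a → s * (r * r) * (c * (a * a)) ≡ c * (s * (r * a * (r * a)))
    regroupʳ = solve-∀

-- m = 2N - 6, c = N - 3.
Zballot-growth : ∀ {n n′ m c t} → 3 ≤ n → n′ ≡ 7 + (n + n) → m ≡ 1 + n′ → c ≡ 4 + n → t ≤ n ! →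
  n′ * (m C c) * (t * t) < n′ !
Zballot-growth {n} 3≤n refl refl refl t≤n! =
  square-bound {x = n′ * ((1 + n′) C (4 + n))} binomial≤ t≤n! growth
  where
  n′ = 7 + (n + n)
  K = n′ ! * (n ! * n !)
  binomial≤ : n′ * ((1 + n′) C (4 + n)) * ((4 + n) ! * (4 + n) !) ≤ n′ * (1 + n′) !
  binomial≤ = begin
    n′ * ((1 + n′) C (4 + n)) * ((4 + n) ! * (4 + n) !)
      ≡⟨ *-assoc n′ ((1 + n′) C (4 + n)) ((4 + n) ! * (4 + n) !) ⟩
    n′ * (((1 + n′) C (4 + n)) * ((4 + n) ! * (4 + n) !))
      ≡⟨ cong (λ x → n′ * (((1 + n′) C (4 + n)) * ((4 + n) ! * x !))) (sym (m+n∸n≡m (4 + n) n)) ⟩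
    n′ * (((1 + n′) C (4 + n)) * ((4 + n) ! * ((1 + n′) ∸ (4 + n)) !))
      ≤⟨ *-monoʳ-≤ n′ (nCk*[k!*[n∸k]!]≤n! (1 + n′) (4 + n)) ⟩
    n′ * (1 + n′) ! ∎
    where open ≤-Reasoning
  rising< : n′ * (1 + n′) < rising n 4 * rising n 4
  rising< = begin-strict
    n′ * (1 + n′)             ≤⟨ *-mono-≤ (m≤n+m n′ 2) (m≤m*n (1 + n′) 1) ⟩
    rising n′ 2               <⟨ rising-double< 1 3≤n ⟩
    rising n 2 * rising n 2   ≤⟨ *-mono-≤ (rising-monoʳ-≤ n 2≤4) (rising-monoʳ-≤ n 2≤4) ⟩
    rising n 4 * rising n 4   ∎
    where
    open ≤-Reasoning
    2≤4 : 2 ≤ 4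
    2≤4 = ≤ᵇ⇒≤ 2 4 tt
  growth : n′ * (1 + n′) ! * (n ! * n !) < n′ ! * ((4 + n) ! * (4 + n) !)
  growth = begin-strict
    n′ * (1 + n′) ! * (n ! * n !)       ≡⟨ regroupˡ n′ (1 + n′) (n′ !) (n !) ⟩
    n′ * (1 + n′) * K                   <⟨ *-monoˡ-< K {{m*n≢0 _ _ {{n′ !≢0}} {{n !* n !≢0}}}} rising< ⟩
    rising n 4 * rising n 4 * K         ≡⟨ regroupʳ (rising n 4) (n′ !) (n !) ⟩
    n′ ! * (rising n 4 * n ! * (rising n 4 * n !))
      ≡⟨ cong (λ x → n′ ! * (x * x)) (+!≡rising*! 4 n) ⟨
    n′ ! * ((4 + n) ! * (4 + n) !)      ∎
    where
    open ≤-Reasoning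
    regroupˡ : ∀ a s c d → a * (s * c) * (d * d) ≡ a * s * (c * (d * d))
    regroupˡ = solve-∀
    regroupʳ : ∀ r c a → r * r * (c * (a * a)) ≡ c * (r * a * (r * a))
    regroupʳ = solve-∀

-- Squaring recursions

^-2^suc : ∀ x e → x ^ (2 ^ suc e) ≡ x ^ (2 ^ e) * x ^ (2 ^ e)
^-2^suc x e = trans (cong (λ k → x ^ (2 ^ e + k)) (+-identityʳ (2 ^ e))) (^-distribˡ-+-* x (2 ^ e) (2 ^ e))

product-map-square : ∀ (f : ℕ → ℕ) xs →
  product (map (λ x → f x * f x) xs) ≡ product (map f xs) * product (map f xs)
product-map-square f [] = refl
product-map-square f (x ∷ xs) =
  trans (cong (f x * f x *_) (product-map-square f xs)) (interchange (f x) (f x) _ _)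

product-upTo-suc : ∀ f n → product (map f (upTo (suc n))) ≡ f 0 * product (map (f ∘ suc) (upTo n))
product-upTo-suc f n =
  cong (λ xs → f 0 * product xs) (trans (map-applyUpTo suc f n) (sym (map-upTo (f ∘ suc) n)))

product-upTo-∷ʳ : ∀ f n → product (map f (upTo (suc n))) ≡ product (map f (upTo n)) * f n
product-upTo-∷ʳ f n = begin
  product (map f (upTo (suc n)))         ≡⟨ cong (product ∘ map f) (upTo-∷ʳ n) ⟨
  product (map f (upTo n ++ n ∷ []))     ≡⟨ cong product (map-++ f (upTo n) (n ∷ [])) ⟩
  product (map f (upTo n) ++ f n ∷ [])   ≡⟨ product-++ (map f (upTo n)) (f n ∷ []) ⟩
  product (map f (upTo n)) * (f n * 1)   ≡⟨ cong (product (map f (upTo n)) *_) (*-identityʳ (f n)) ⟩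
  product (map f (upTo n)) * f n         ∎
  where open ≡-Reasoning

zigzagTail : ℕ → ℕ
zigzagTail ℓ = 10 ^ (2 ^ (ℓ ∸ 4)) * βProd ℓ

Tzigzag≡β*zigzagTail : ∀ ℓ → Tzigzag ℓ ≡ β ℓ * zigzagTail ℓ
Tzigzag≡β*zigzagTail ℓ = trans (*-assoc a (β ℓ) (βProd ℓ)) (x∙yz≈y∙xz a (β ℓ) (βProd ℓ))
  where a = 10 ^ (2 ^ (ℓ ∸ 4))

Zzigzag≡γ*zigzagTail : ∀ ℓ → Zzigzag ℓ ≡ γ ℓ * zigzagTail ℓ
Zzigzag≡γ*zigzagTail ℓ = trans (*-assoc a (γ ℓ) (βProd ℓ)) (x∙yz≈y∙xz a (γ ℓ) (βProd ℓ))
  where a = 10 ^ (2 ^ (ℓ ∸ 4))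

βProd-suc : ∀ m → βProd (5 + m) ≡ β (4 + m) * (βProd (4 + m) * βProd (4 + m))
βProd-suc m = begin
  product (map g (upTo (suc m)))
    ≡⟨ product-upTo-∷ʳ g m ⟩
  product (map g (upTo m)) * g m
    ≡⟨ cong₂ _*_ (cong product (map-cong-local (All.map halve (All.all-upTo m)))) last ⟩
  product (map (λ j → g′ j * g′ j) (upTo m)) * β (4 + m)
    ≡⟨ cong (_* β (4 + m)) (product-map-square g′ (upTo m)) ⟩
  βProd (4 + m) * βProd (4 + m) * β (4 + m)
    ≡⟨ *-comm _ (β (4 + m)) ⟩
  β (4 + m) * (βProd (4 + m) * βProd (4 + m)) ∎
  where
  open ≡-Reasoning
  g g′ : ℕ → ℕ
  g j = β (4 + j) ^ (2 ^ (m ∸ j))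
  g′ j = β (4 + j) ^ (2 ^ (m ∸ suc j))
  halve : ∀ {j} → j < m → g j ≡ g′ j * g′ j
  halve {j} j<m = trans (cong (λ e → β (4 + j) ^ (2 ^ e)) (+-∸-assoc 1 j<m)) (^-2^suc (β (4 + j)) (m ∸ suc j))
  last : g m ≡ β (4 + m)
  last = trans (cong (λ e → β (4 + m) ^ (2 ^ e)) (n∸n≡0 m)) (*-identityʳ (β (4 + m)))

zigzagTail-suc : ∀ m → zigzagTail (5 + m) ≡ β (4 + m) * (zigzagTail (4 + m) * zigzagTail (4 + m))
zigzagTail-suc m = begin
  10 ^ (2 ^ suc m) * βProd (5 + m)
    ≡⟨ cong₂ _*_ (^-2^suc 10 m) (βProd-suc m) ⟩
  (10 ^ (2 ^ m) * 10 ^ (2 ^ m)) * (β (4 + m) * (βProd (4 + m) * βProd (4 + m)))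
    ≡⟨ regroup (10 ^ (2 ^ m)) (β (4 + m)) (βProd (4 + m)) ⟩
  β (4 + m) * (zigzagTail (4 + m) * zigzagTail (4 + m)) ∎
  where
  open ≡-Reasoning
  regroup : ∀ a b c → a * a * (b * (c * c)) ≡ b * ((a * c) * (a * c))
  regroup = solve-∀

tailFactorials-suc : ∀ k → factProd (tailParts (4 + k)) ≡ factProd (tailParts (3 + k)) * (2 ^ suc k ∸ 1) !
tailFactorials-suc k = begin
  product (map _! (map h (upTo (suc k))))   ≡⟨ cong product (map-∘ (upTo (suc k))) ⟨
  product (map (_! ∘ h) (upTo (suc k)))     ≡⟨ product-upTo-∷ʳ (_! ∘ h) k ⟩
  product (map (_! ∘ h) (upTo k)) * h k !   ≡⟨ cong (λ xs → product xs * h k !) (map-∘ (upTo k)) ⟩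
  product (map _! (map h (upTo k))) * h k ! ∎
  where
  open ≡-Reasoning
  h : ℕ → ℕ
  h j = 2 ^ suc j ∸ 1

ballotFactor : ℕ → ℕ
ballotFactor ℓ = (2 ^ ℓ ∸ 4) * catalan (2 ^ (ℓ ∸ 1) ∸ 1)

Tballot-suc : ∀ m → Tballot (5 + m) ≡ ballotFactor (5 + m) * (Tballot (4 + m) * Tballot (4 + m))
Tballot-suc m = begin
  10 ^ (2 ^ (2 + m)) * product (map f (upTo (2 + m)))
    ≡⟨ cong₂ _*_ (^-2^suc 10 (suc m)) (product-upTo-suc f (suc m)) ⟩
  (a * a) * (ballotFactor (5 + m) ^ 1 * product (map (f ∘ suc) (upTo (suc m))))
    ≡⟨ cong₂ (λ x y → (a * a) * (x * y)) (*-identityʳ (ballotFactor (5 + m)))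
             (trans (cong product (map-cong (λ i → ^-2^suc (ballotFactor (4 + m ∸ i)) i) (upTo (suc m))))
                    (product-map-square f′ (upTo (suc m)))) ⟩
  (a * a) * (ballotFactor (5 + m) * (product (map f′ (upTo (suc m))) * product (map f′ (upTo (suc m)))))
    ≡⟨ regroup a (ballotFactor (5 + m)) (product (map f′ (upTo (suc m)))) ⟩
  ballotFactor (5 + m) * (Tballot (4 + m) * Tballot (4 + m)) ∎
  where
  open ≡-Reasoning
  a = 10 ^ (2 ^ suc m)
  f f′ : ℕ → ℕ
  f i = ballotFactor (5 + m ∸ i) ^ (2 ^ i)
  f′ i = ballotFactor (4 + m ∸ i) ^ (2 ^ i)
  regroup : ∀ a b c → a * a * (b * (c * c)) ≡ b * ((a * c) * (a * c))
  regroup = solve-∀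

-- The ℕ factor of Zballot ℓ, verbatim from its definition.
ZballotTail : ℕ → ℕ
ZballotTail ℓ = 10 ^ (2 ^ (ℓ ∸ 3))
  * prodRange 0 (ℓ ∸ 5) (λ i → ((2 ^ (ℓ ∸ 1 ∸ i) ∸ 4) * catalan (2 ^ (ℓ ∸ i ∸ 2) ∸ 1)) ^ (2 ^ suc i))

ZballotTail-suc : ∀ m → ZballotTail (5 + m) ≡ Tballot (4 + m) * Tballot (4 + m)
ZballotTail-suc m = begin
  10 ^ (2 ^ (2 + m)) * product (map f (upTo (suc m)))
    ≡⟨ cong₂ _*_ (^-2^suc 10 (suc m)) (cong product (map-cong square (upTo (suc m)))) ⟩
  (a * a) * product (map (λ i → f′ i * f′ i) (upTo (suc m)))
    ≡⟨ cong ((a * a) *_) (product-map-square f′ (upTo (suc m))) ⟩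
  (a * a) * (product (map f′ (upTo (suc m))) * product (map f′ (upTo (suc m))))
    ≡⟨ interchange a a _ _ ⟩
  Tballot (4 + m) * Tballot (4 + m) ∎
  where
  open ≡-Reasoning
  a = 10 ^ (2 ^ suc m)
  f f′ : ℕ → ℕ
  f i = ((2 ^ (4 + m ∸ i) ∸ 4) * catalan (2 ^ (5 + m ∸ i ∸ 2) ∸ 1)) ^ (2 ^ suc i)
  f′ i = ballotFactor (4 + m ∸ i) ^ (2 ^ i)
  shift : ∀ i → 5 + m ∸ i ∸ 2 ≡ 4 + m ∸ i ∸ 1
  shift i = begin
    5 + m ∸ i ∸ 2     ≡⟨ ∸-+-assoc (5 + m) i 2 ⟩
    5 + m ∸ (i + 2)   ≡⟨ cong (5 + m ∸_) (+-suc i 1) ⟩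
    4 + m ∸ (i + 1)   ≡⟨ ∸-+-assoc (4 + m) i 1 ⟨
    4 + m ∸ i ∸ 1     ∎
  square : ∀ i → f i ≡ f′ i * f′ i
  square i = trans (cong (λ k → ((2 ^ (4 + m ∸ i) ∸ 4) * catalan (2 ^ k ∸ 1)) ^ (2 ^ suc i)) (shift i))
                   (^-2^suc (ballotFactor (4 + m ∸ i)) i)

-- Arithmetic of the level ℓ = 5 + m, where N = 2 ^ ℓ and n = N - 7

∸-split : ∀ {x j k} → k ≤ j → j ≤ x → x ∸ k ≡ (j ∸ k) + (x ∸ j)
∸-split {x} {j} {k} k≤j j≤x = trans (cong (_∸ k) (sym (m+[n∸m]≡n j≤x))) (+-∸-comm (x ∸ j) k≤j)

module Level (m : ℕ) where

  n : ℕ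
  n = 2 ^ (5 + m) ∸ 7

  private
    2^<2^suc : ∀ k → 2 ^ k < 2 ^ suc k
    2^<2^suc k = ^-monoʳ-< 2 (n<1+n 1) (n<1+n k)

    2^≤2^[+m] : ∀ k → 2 ^ k ≤ 2 ^ (k + m)
    2^≤2^[+m] k = ^-monoʳ-≤ 2 (m≤m+n k m)

    7≤N : 7 ≤ 2 ^ (5 + m)
    7≤N = ≤-trans (≤ᵇ⇒≤ 7 32 tt) (2^≤2^[+m] 5)

    7≤2N : 7 ≤ 2 ^ (6 + m)
    7≤2N = ≤-trans 7≤N (<⇒≤ (2^<2^suc (5 + m)))

  3≤n : 3 ≤ n
  3≤n = ≤-trans (≤ᵇ⇒≤ 3 25 tt) (∸-monoˡ-≤ 7 (2^≤2^[+m] 5))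

  N∸1≡6+n : 2 ^ (5 + m) ∸ 1 ≡ 6 + n
  N∸1≡6+n = ∸-split (≤ᵇ⇒≤ 1 7 tt) 7≤N

  N∸2≡5+n : 2 ^ (5 + m) ∸ 2 ≡ 5 + n
  N∸2≡5+n = ∸-split (≤ᵇ⇒≤ 2 7 tt) 7≤N

  N∸3≡4+n : 2 ^ (5 + m) ∸ 3 ≡ 4 + n
  N∸3≡4+n = ∸-split (≤ᵇ⇒≤ 3 7 tt) 7≤N

  N∸3≡2+[N∸5] : 2 ^ (5 + m) ∸ 3 ≡ 2 + (2 ^ (5 + m) ∸ 5)
  N∸3≡2+[N∸5] = ∸-split (≤ᵇ⇒≤ 3 5 tt) (≤-trans (≤ᵇ⇒≤ 5 7 tt) 7≤N)

  N∸4≡1+[N∸5] : 2 ^ (5 + m) ∸ 4 ≡ 1 + (2 ^ (5 + m) ∸ 5)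
  N∸4≡1+[N∸5] = ∸-split (≤ᵇ⇒≤ 4 5 tt) (≤-trans (≤ᵇ⇒≤ 5 7 tt) 7≤N)

  2N∸7≡7+[n+n] : 2 ^ (6 + m) ∸ 7 ≡ 7 + (n + n)
  2N∸7≡7+[n+n] = trans (cong (λ x → 2 * x ∸ 7) (sym (m+[n∸m]≡n 7≤N))) (double n)
    where
    double : ∀ n → n + ((7 + n) + 0) ≡ 7 + (n + n)
    double = solve-∀

  2N∸3≡4+[2N∸7] : 2 ^ (6 + m) ∸ 3 ≡ 4 + (2 ^ (6 + m) ∸ 7)
  2N∸3≡4+[2N∸7] = ∸-split (≤ᵇ⇒≤ 3 7 tt) 7≤2N

  2N∸4≡3+[2N∸7] : 2 ^ (6 + m) ∸ 4 ≡ 3 + (2 ^ (6 + m) ∸ 7)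
  2N∸4≡3+[2N∸7] = ∸-split (≤ᵇ⇒≤ 4 7 tt) 7≤2N

  2N∸6≡1+[2N∸7] : 2 ^ (6 + m) ∸ 6 ≡ 1 + (2 ^ (6 + m) ∸ 7)
  2N∸6≡1+[2N∸7] = ∸-split (≤ᵇ⇒≤ 6 7 tt) 7≤2N

  -- half = N/2 = 2 ^ (4 + m) and quarter = N/4 = 2 ^ (3 + m)
  half∸2≡1+[half∸3] : 2 ^ (4 + m) ∸ 2 ≡ 1 + (2 ^ (4 + m) ∸ 3)
  half∸2≡1+[half∸3] = ∸-split (≤ᵇ⇒≤ 2 3 tt) (≤-trans (≤ᵇ⇒≤ 3 16 tt) (2^≤2^[+m] 4))

  quarter∸2≡1+[quarter∸3] : 2 ^ (3 + m) ∸ 2 ≡ 1 + (2 ^ (3 + m) ∸ 3)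
  quarter∸2≡1+[quarter∸3] = ∸-split (≤ᵇ⇒≤ 2 3 tt) (≤-trans (≤ᵇ⇒≤ 3 8 tt) (2^≤2^[+m] 3))

  quarter∸1≡1+[quarter∸2] : 2 ^ (3 + m) ∸ 1 ≡ 1 + (2 ^ (3 + m) ∸ 2)
  quarter∸1≡1+[quarter∸2] = ∸-split (≤ᵇ⇒≤ 1 2 tt) (≤-trans (≤ᵇ⇒≤ 2 8 tt) (2^≤2^[+m] 3))

  half∸2≤N∸3 : 2 ^ (4 + m) ∸ 2 ≤ 2 ^ (5 + m) ∸ 3
  half∸2≤N∸3 = ∸-monoˡ-≤ 3 (2^<2^suc (4 + m))

  quarter∸2≤N∸4 : 2 ^ (3 + m) ∸ 2 ≤ 1 + (2 ^ (5 + m) ∸ 5)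
  quarter∸2≤N∸4 = subst (2 ^ (3 + m) ∸ 2 ≤_) N∸4≡1+[N∸5]
    (∸-monoˡ-≤ 4 (≤-trans (s≤s (2^<2^suc (3 + m))) (2^<2^suc (4 + m))))

ZigzagInvariant : ℕ → Set
ZigzagInvariant ℓ = zigzagTail ℓ * (2 ^ ℓ ∸ 3) ! < (2 ^ ℓ ∸ 7) ! * factProd (βParts ℓ)

zigzag-invariant : ∀ m → ZigzagInvariant (5 + m)
zigzag-invariant zero = <ᵇ⇒< _ _ tt
zigzag-invariant (suc m) =
  subst₂ (λ t E′ → t * G₃ < G₇ * (A₂ * (A * E′))) (sym (zigzagTail-suc (suc m))) (sym (tailFactorials-suc (2 + m)))
    (zigzag-propagation {β (5 + m)} {zigzagTail (5 + m)} {c} {n !} {A} {B} {E} {G₃} {G₇} {A₂} {B′}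
      {{(2 ^ (5 + m) ∸ 3) !≢0}} {{(2 ^ (4 + m) ∸ 2) !≢0}} {{(2 ^ (3 + m) ∸ 2) !≢0}}
      {{factProd≢0 (tailParts (5 + m))}}
      (β-bound (5 + m)) (zigzag-invariant m)
      (zigzag-growth 3≤n N∸2≡5+n N∸3≡4+n 2N∸7≡7+[n+n] 2N∸3≡4+[2N∸7] quarter∸1≡1+[quarter∸2]))
  where
  open Level m
  c = (2 ^ (5 + m) ∸ 3) !
  A = (2 ^ (4 + m) ∸ 2) !
  B = (2 ^ (3 + m) ∸ 2) !
  E = factProd (tailParts (5 + m))
  G₃ = (2 ^ (6 + m) ∸ 3) !
  G₇ = (2 ^ (6 + m) ∸ 7) !
  A₂ = (2 ^ (5 + m) ∸ 2) !
  B′ = (2 ^ (3 + m) ∸ 1) !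

Tzigzag-bound : ∀ m → Tzigzag (5 + m) < (2 ^ (5 + m) ∸ 7) !
Tzigzag-bound m = subst (_< (2 ^ (5 + m) ∸ 7) !) (sym (Tzigzag≡β*zigzagTail (5 + m)))
  (ratio-bound {β (5 + m)} {zigzagTail (5 + m)} {c} {_} {c} {F} {F} {{(2 ^ (5 + m) ∸ 3) !≢0}}
    (β-bound (5 + m)) (zigzag-invariant m) ≤-refl)
  where
  c = (2 ^ (5 + m) ∸ 3) !
  F = factProd (βParts (5 + m))

Zzigzag-bound : ∀ m → Zzigzag (5 + m) < (2 ^ (5 + m) ∸ 7) !
Zzigzag-bound m = subst (_< (2 ^ (5 + m) ∸ 7) !) (sym (Zzigzag≡γ*zigzagTail (5 + m)))
  (ratio-bound {γ (5 + m)} {zigzagTail (5 + m)} {(2 ^ (5 + m) ∸ 3) !} {_} {(2 ^ (5 + m) ∸ 5) !}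
               {factProd (βParts (5 + m))} {factProd (γParts (5 + m))} {{(2 ^ (5 + m) ∸ 5) !≢0}}
    (γ-bound (5 + m)) (zigzag-invariant m)
    (factorial-ratio (factProd (tailParts (5 + m))) N∸3≡2+[N∸5] half∸2≡1+[half∸3] quarter∸2≡1+[quarter∸3]
      half∸2≤N∸3 quarter∸2≤N∸4))
  where open Level m

Tballot-bound : ∀ m → Tballot (5 + m) < (2 ^ (5 + m) ∸ 7) !
Tballot-bound zero = <ᵇ⇒< _ _ tt
Tballot-bound (suc m) = subst (_< (2 ^ (6 + m) ∸ 7) !) (sym (Tballot-suc (suc m)))
  (ballot-growth 3≤n 2N∸7≡7+[n+n] 2N∸4≡3+[2N∸7] N∸1≡6+n (<⇒≤ (Tballot-bound m)))
  where open Level m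

Zballot-bound : ∀ m → Zballot (5 + m) ℤ.< + ((2 ^ (5 + m) ∸ 7) !)
Zballot-bound zero = ℤ.+<+ (<ᵇ⇒< _ _ tt)
Zballot-bound (suc m) =
  subtraction-bound {a} {M C (2 ^ (5 + m) ∸ 3)} {M C (2 ^ (5 + m) ∸ 6)} {ZballotTail (6 + m)}
    (subst (λ z → a * (M C (2 ^ (5 + m) ∸ 3)) * z < a !) (sym (ZballotTail-suc (suc m)))
      (Zballot-growth 3≤n 2N∸7≡7+[n+n] 2N∸6≡1+[2N∸7] N∸3≡4+n (<⇒≤ (Tballot-bound m))))
  where
  open Level m
  a = 2 ^ (6 + m) ∸ 7
  M = 2 ^ (6 + m) ∸ 6

mainTheorem12 : (ℓ : ℕ) → 5 ≤ ℓ →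
    (Tzigzag ℓ < (2 ^ ℓ ∸ 7) !) × (Zzigzag ℓ < (2 ^ ℓ ∸ 7) !)
      × (Tballot ℓ < (2 ^ ℓ ∸ 7) !) × (Zballot ℓ ℤ.< + ((2 ^ ℓ ∸ 7) !))
mainTheorem12 (suc (suc (suc (suc (suc m))))) (s≤s (s≤s (s≤s (s≤s (s≤s _))))) =
  Tzigzag-bound m , Zzigzag-bound m , Tballot-bound m , Zballot-bound m
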